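{- Let $(M, S_{1}, S_{2}, \ldots, \partial)$ be a model of ${\tt \Delta^{1}_{1}\text{ - }BL}_{0}$. For every $A\in S_{1}$ with $A \subseteq \mathrm{rng}\,\partial$, there is $B\in S_{1}$ with $B\subseteq A$ and $\partial B\in \mathrm{rng}\,\partial\setminus A$.
   Context: Structures $(M,S_1,S_2,\ldots,\partial)$ are many-sorted: objects $M$, $n$-ary relations $S_n\subseteq P(M^n)$ (elements of $S_1$ are sets), and $\partial:S_1\to M$; $\mathrm{rng}\,\partial=\{\partial X: X\in S_1\}$. Basic Law V: $\partial X=\partial Y\leftrightarrow X=Y$. Arithmetical formulas have no bound relation variables (may contain $\partial$); $\Sigma^1_1$ ($\Pi^1_1$) formulas are arithmetical formulas preceded by a block of existential (universal) relation quantifiers of any arities. ${\tt \Delta^1_1\text{ - }BL}_0$: Basic Law V plus $[\forall\bar n(\varphi(\bar n)\leftrightarrow\psi(\bar n))]\to\exists R\forall\bar n[\bar n\in R\leftrightarrow\varphi(\bar n)]$ for $\Sigma^1_1$ $\varphi$, $\Pi^1_1$ $\psi$ (parameters allowed). -}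

module Defs where

open import Data.Nat using (ℕ; zero; suc; _+_)
open import Data.Fin using (Fin)
open import Data.List using (List; []; _∷_; _++_)
open import Data.Vec using (Vec; []; _∷_; lookup) renaming (_++_ to _++ᵛ_)
open import Data.Product using (Σ; ∃; _×_; _,_)
open import Data.Sum using (_⊎_)
open import Data.Empty using (⊥)
open import Relation.Binary.PropositionalEquality using (_≡_)
open import Function.Bundles using (_⇔_)

-- S n is the sort of n-ary relations; an element R of S n is a subset of
-- M^n, given by its membership predicate, and extensionality makes
-- S n literally a collection of subsets of M^n.

record Structure : Set₁ where
  field
    M    : Set
    S    : ℕ → Set
    _∈_  : ∀ {n} → Vec M n → S n → Set
    ext  : ∀ {n} (X Y : S n) → (∀ v → (v ∈ X) ⇔ (v ∈ Y)) → X ≡ Y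
    ∂    : S 1 → M

data RVar : List ℕ → ℕ → Set where
  here  : ∀ {Γ n} → RVar (n ∷ Γ) n
  there : ∀ {Γ m n} → RVar Γ n → RVar (m ∷ Γ) n

data Term (k : ℕ) (Γ : List ℕ) : Set where
  var : Fin k → Term k Γ
  ∂t  : RVar Γ 1 → Term k Γ

data Arith : ℕ → List ℕ → Set where
  _≐_  : ∀ {k Γ} → Term k Γ → Term k Γ → Arith k Γ
  mem  : ∀ {k Γ n} → Vec (Term k Γ) n → RVar Γ n → Arith k Γ
  ⊥f   : ∀ {k Γ} → Arith k Γ
  _∧f_ : ∀ {k Γ} → Arith k Γ → Arith k Γ → Arith k Γ
  _∨f_ : ∀ {k Γ} → Arith k Γ → Arith k Γ → Arith k Γ
  _⇒f_ : ∀ {k Γ} → Arith k Γ → Arith k Γ → Arith k Γ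
  ∀o   : ∀ {k Γ} → Arith (suc k) Γ → Arith k Γ
  ∃o   : ∀ {k Γ} → Arith (suc k) Γ → Arith k Γ

-- Σ¹₁ / Π¹₁ formulas: a block of existential / universal relation
-- quantifiers of arities Δ (any arities) before an arithmetical matrix.
record Σ¹₁ (k : ℕ) (Γ : List ℕ) : Set where
  constructor ∃block
  field
    Δ      : List ℕ
    matrix : Arith k (Δ ++ Γ)

record Π¹₁ (k : ℕ) (Γ : List ℕ) : Set where
  constructor ∀block
  field
    Δ      : List ℕ
    matrix : Arith k (Δ ++ Γ)

module Semantics (𝔐 : Structure) where
  open Structure 𝔐

  REnv : List ℕ → Set
  REnv Γ = ∀ {n} → RVar Γ n → S n

  _++ᴿ_ : ∀ {Δ Γ} → REnv Δ → REnv Γ → REnv (Δ ++ Γ)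
  _++ᴿ_ {[]}    σ ρ x         = ρ x
  _++ᴿ_ {m ∷ Δ} σ ρ here      = σ here
  _++ᴿ_ {m ∷ Δ} σ ρ (there x) = _++ᴿ_ {Δ} (λ y → σ (there y)) ρ x

  OEnv : ℕ → Set
  OEnv k = Fin k → M

  extendO : ∀ {k} → M → OEnv k → OEnv (suc k)
  extendO a θ Fin.zero    = a
  extendO a θ (Fin.suc i) = θ i

  evalT : ∀ {k Γ} → REnv Γ → OEnv k → Term k Γ → M
  evalT ρ θ (var i) = θ i
  evalT ρ θ (∂t X)  = ∂ (ρ X)

  evalTs : ∀ {k Γ n} → REnv Γ → OEnv k → Vec (Term k Γ) n → Vec M n
  evalTs ρ θ []       = []
  evalTs ρ θ (t ∷ ts) = evalT ρ θ t ∷ evalTs ρ θ ts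

  sat : ∀ {k Γ} → REnv Γ → OEnv k → Arith k Γ → Set
  sat ρ θ (t ≐ u)   = evalT ρ θ t ≡ evalT ρ θ u
  sat ρ θ (mem ts X) = evalTs ρ θ ts ∈ ρ X
  sat ρ θ ⊥f        = ⊥
  sat ρ θ (φ ∧f ψ)  = sat ρ θ φ × sat ρ θ ψ
  sat ρ θ (φ ∨f ψ)  = sat ρ θ φ ⊎ sat ρ θ ψ
  sat ρ θ (φ ⇒f ψ)  = sat ρ θ φ → sat ρ θ ψ
  sat ρ θ (∀o φ)    = (a : M) → sat ρ (extendO a θ) φ
  sat ρ θ (∃o φ)    = Σ M λ a → sat ρ (extendO a θ) φ

  satΣ : ∀ {k Γ} → REnv Γ → OEnv k → Σ¹₁ k Γ → Set
  satΣ ρ θ (∃block Δ φ) = Σ (REnv Δ) λ σ → sat (σ ++ᴿ ρ) θ φ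

  satΠ : ∀ {k Γ} → REnv Γ → OEnv k → Π¹₁ k Γ → Set
  satΠ ρ θ (∀block Δ φ) = (σ : REnv Δ) → sat (σ ++ᴿ ρ) θ φ

-- In the comprehension scheme the formulas have n + p free object
-- variables: the first n are n̄, the remaining p are object parameters;
-- free relation variables (context Γ) are relation parameters.

record IsΔ¹₁-BL₀ (𝔐 : Structure) : Set where
  open Structure 𝔐
  open Semantics 𝔐
  field
    basicLawV : (X Y : S 1) → (∂ X ≡ ∂ Y) ⇔ (X ≡ Y)
    Δ¹₁-CA : ∀ (n p : ℕ) (Γ : List ℕ)
               (φ : Σ¹₁ (n + p) Γ) (ψ : Π¹₁ (n + p) Γ)
               (ρ : REnv Γ) (q : Vec M p) →
               (∀ (v : Vec M n) → satΣ ρ (lookup (v ++ᵛ q)) φ ⇔ satΠ ρ (lookup (v ++ᵛ q)) ψ) →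
               Σ (S n) λ R → ∀ (v : Vec M n) → (v ∈ R) ⇔ satΣ ρ (lookup (v ++ᵛ q)) φ

-- Take B = {x ∈ A : x = ∂X for some X with x ∉ X}.  Since A ⊆ rng ∂ and ∂ is
-- injective (Basic Law V), "x = ∂X for some X with x ∉ X" is equivalent on A to
-- "x ∉ X for every X with ∂X = x", so B is Δ¹₁-definable and exists.  Russell's
-- argument gives ∂B ∉ B, and then ∂B ∉ A, for otherwise ∂B would belong to B.
module Submission where

open import Defs
open import Data.Vec using (Vec; []; _∷_; lookup; _++_)
open import Data.Product using (Σ; _×_; _,_; proj₁; proj₂)
open import Data.Fin using () renaming (zero to fz)
open import Data.List using () renaming (_∷_ to _∷ˡ_; [] to []ˡ)
open import Relation.Binary.PropositionalEquality using (_≡_; refl; sym; trans; subst)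
open import Relation.Nullary using (¬_)
open import Function.Bundles using (_⇔_; mk⇔; Equivalence)
open import Function.Construct.Composition using (_⇔-∘_)

module _ (𝔐 : Structure) where
  open Structure 𝔐
  open Semantics 𝔐

  _∈₁_ : M → S 1 → Set
  x ∈₁ X = (x ∷ []) ∈ X

  InRange : M → Set
  InRange x = Σ (S 1) λ X → ∂ X ≡ x

  RussellIn : S 1 → M → Set
  RussellIn A x = x ∈₁ A × Σ (S 1) λ X → ∂ X ≡ x × ¬ x ∈₁ X

  Injective∂ : Set
  Injective∂ = ∀ X Y → ∂ X ≡ ∂ Y → X ≡ Y

  module _ (∂-injective : Injective∂) where

    some-preimage⇔every-preimage : ∀ {x} → InRange x →
      (Σ (S 1) λ X → ∂ X ≡ x × ¬ x ∈₁ X) ⇔ (∀ X → ∂ X ≡ x → ¬ x ∈₁ X)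
    some-preimage⇔every-preimage {x} (X₀ , ∂X₀≡x) = mk⇔ to from
      where
      to : (Σ (S 1) λ X → ∂ X ≡ x × ¬ x ∈₁ X) → ∀ Y → ∂ Y ≡ x → ¬ x ∈₁ Y
      to (X , ∂X≡x , x∉X) Y ∂Y≡x x∈Y =
        x∉X (subst (x ∈₁_) (∂-injective Y X (trans ∂Y≡x (sym ∂X≡x))) x∈Y)
      from : (∀ Y → ∂ Y ≡ x → ¬ x ∈₁ Y) → Σ (S 1) λ X → ∂ X ≡ x × ¬ x ∈₁ X
      from every = X₀ , ∂X₀≡x , every X₀ ∂X₀≡x

    ∂-∉-RussellSet : ∀ {A B} → (∀ x → x ∈₁ B ⇔ RussellIn A x) → ¬ ∂ B ∈₁ B
    ∂-∉-RussellSet {B = B} B-spec ∂B∈B with Equivalence.to (B-spec (∂ B)) ∂B∈B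
    ... | _ , X , ∂X≡∂B , ∂B∉X = ∂B∉X (subst (∂ B ∈₁_) (∂-injective B X (sym ∂X≡∂B)) ∂B∈B)

    ∂-RussellSet-∉ : ∀ {A B} → (∀ x → x ∈₁ B ⇔ RussellIn A x) → ¬ ∂ B ∈₁ A
    ∂-RussellSet-∉ {B = B} B-spec ∂B∈A =
      ∂-∉-RussellSet B-spec (Equivalence.from (B-spec (∂ B)) (∂B∈A , B , refl , ∂-∉-RussellSet B-spec))

  -- The formula x ∈ A ∧ ∂X = x ∧ x ∉ X in the object variable x = var fz, the
  -- bound relation variable X = here and the parameter A = there here.
  russellΣ : Σ¹₁ 1 (1 ∷ˡ []ˡ)
  russellΣ = ∃block (1 ∷ˡ []ˡ) (mem (var fz ∷ []) (there here)
                              ∧f ((∂t here ≐ var fz) ∧f (mem (var fz ∷ []) here ⇒f ⊥f)))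

  russellΠ : Π¹₁ 1 (1 ∷ˡ []ˡ)
  russellΠ = ∀block (1 ∷ˡ []ˡ) (mem (var fz ∷ []) (there here)
                              ∧f ((∂t here ≐ var fz) ⇒f (mem (var fz ∷ []) here ⇒f ⊥f)))

  singleton : S 1 → REnv (1 ∷ˡ []ˡ)
  singleton X here = X

  value : M → OEnv 1
  value x = lookup ((x ∷ []) ++ [])

  satΣ-russellΣ⇔ : ∀ A x → satΣ (singleton A) (value x) russellΣ ⇔ RussellIn A x
  satΣ-russellΣ⇔ A x = mk⇔ (λ (σ , x∈A , ∂≡x , x∉) → x∈A , σ here , ∂≡x , x∉)
                             (λ (x∈A , X , ∂X≡x , x∉X) → singleton X , x∈A , ∂X≡x , x∉X)

  satΠ-russellΠ⇔ : ∀ A x → satΠ (singleton A) (value x) russellΠ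
                         ⇔ (x ∈₁ A × ∀ X → ∂ X ≡ x → ¬ x ∈₁ X)
  satΠ-russellΠ⇔ A x = mk⇔ to from
    where
    to : satΠ (singleton A) (value x) russellΠ → x ∈₁ A × ∀ X → ∂ X ≡ x → ¬ x ∈₁ X
    to all = proj₁ (all (singleton A)) , λ X → proj₂ (all (singleton X))
    from : x ∈₁ A × (∀ X → ∂ X ≡ x → ¬ x ∈₁ X) → satΠ (singleton A) (value x) russellΠ
    from (x∈A , every) σ = x∈A , every (σ here)

  module _ (H : IsΔ¹₁-BL₀ 𝔐) where
    open IsΔ¹₁-BL₀ H

    ∂-injective : Injective∂
    ∂-injective X Y = Equivalence.to (basicLawV X Y)

  module _ (H : IsΔ¹₁-BL₀ 𝔐) (A : S 1) (A⊆rng∂ : ∀ x → x ∈₁ A → InRange x) where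
    open IsΔ¹₁-BL₀ H using (Δ¹₁-CA)

    russellΣ⇔russellΠ : ∀ (v : Vec M 1) →
      satΣ (singleton A) (lookup (v ++ [])) russellΣ ⇔ satΠ (singleton A) (lookup (v ++ [])) russellΠ
    russellΣ⇔russellΠ (x ∷ []) = mk⇔ to from
      where
      to : satΣ (singleton A) (value x) russellΣ → satΠ (singleton A) (value x) russellΠ
      to s with Equivalence.to (satΣ-russellΣ⇔ A x) s
      ... | x∈A , some = Equivalence.from (satΠ-russellΠ⇔ A x)
                           (x∈A , Equivalence.to (some-preimage⇔every-preimage (∂-injective H) (A⊆rng∂ x x∈A)) some)
      from : satΠ (singleton A) (value x) russellΠ → satΣ (singleton A) (value x) russellΣ
      from p with Equivalence.to (satΠ-russellΠ⇔ A x) p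
      ... | x∈A , every = Equivalence.from (satΣ-russellΣ⇔ A x)
                            (x∈A , Equivalence.from (some-preimage⇔every-preimage (∂-injective H) (A⊆rng∂ x x∈A)) every)

    russellSet : Σ (S 1) λ B → ∀ x → x ∈₁ B ⇔ RussellIn A x
    russellSet with Δ¹₁-CA 1 0 (1 ∷ˡ []ˡ) russellΣ russellΠ (singleton A) [] russellΣ⇔russellΠ
    ... | B , B-spec = B , λ x → satΣ-russellΣ⇔ A x ⇔-∘ B-spec (x ∷ [])

proposition3p5 : (𝔐 : Structure) → IsΔ¹₁-BL₀ 𝔐 →
    let open Structure 𝔐 in
    (A : S 1) → (∀ (x : M) → (x ∷ []) ∈ A → Σ (S 1) λ X → ∂ X ≡ x) →
    Σ (S 1) λ B →
    (∀ (x : M) → (x ∷ []) ∈ B → (x ∷ []) ∈ A)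
    × ((Σ (S 1) λ X → ∂ X ≡ ∂ B) × ¬ ((∂ B ∷ []) ∈ A))
proposition3p5 𝔐 H A A⊆rng∂ with russellSet 𝔐 H A A⊆rng∂
... | B , B-spec =
  B , (λ x x∈B → proj₁ (Equivalence.to (B-spec x) x∈B))
    , (B , refl)
    , ∂-RussellSet-∉ 𝔐 (∂-injective 𝔐 H) B-spec
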